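{- Let $d\in\mathbb N$ and let $\ell_1,\ell_2\geq d'\geq 1$ be integers with $d'+\ell_1+\ell_2\leq d$. Let $w=(w_{i,j})\in\mathbb Z^{V_d}$ be a chip configuration and $w'=(w_{i,j})_{(i,j)\in V_{d'}}\in\mathbb Z^{V_{d'}}$. Suppose $\mathrm{supp}(w)\subseteq V_{d'}\cup\{(i,j)\in V_d\mid j>d-\ell_1\}\cup\{(i,j)\in V_d\mid i>d-\ell_2\}$. Then: (a) if $w'$ is not an outcome (in $\mathbb Z^{V_{d'}}$), then $w$ is not an outcome; (b) if $w$ is a valid outcome, then $\deg(w)\leq d'$.
   Context: $V_d=\{(i,j)\in\mathbb Z_{\geq0}^2\mid i+j\leq d\}$, $\deg(i,j)=i+j$. A chip configuration is $w\in\mathbb Z^{V_d}$. A splitting move at $p\in V_{d-1}$ decreases $w_p$ by $1$ and increases $w_{p+(1,0)}$, $w_{p+(0,1)}$ by $1$; an unsplitting move is its inverse; an outcome is a configuration reachable from the zero configuration by finitely many moves (in $\mathbb Z^{V_{d'}}$ the same with $d'$ in place of $d$). $\mathrm{supp}(w)=\{(i,j)\mid w_{i,j}\neq0\}$, $\deg(w)=\max\{i+j\mid(i,j)\in\mathrm{supp}(w)\}$; $w$ is valid if $w_{i,j}\geq 0$ for all $(i,j)\neq(0,0)$. -}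

module Defs where

open import Data.Nat using (ℕ; zero; suc; _+_; _∸_; _≤_; _<_; _≟_)
open import Data.Integer as ℤ using (ℤ; 0ℤ; 1ℤ)
open import Data.Product using (_×_; _,_)
open import Data.Sum using (_⊎_)
open import Relation.Nullary using (¬_; yes; no)
open import Relation.Nullary.Decidable using (⌊_⌋)
open import Relation.Binary.PropositionalEquality using (_≡_; _≢_)
open import Data.Bool using (Bool; true; false; _∧_; if_then_else_)

-- A chip configuration: an integer at every lattice point (i , j) ∈ ℕ².
-- An element of ℤ^{V_d} is such a configuration vanishing outside V_d.
Config : Set
Config = ℕ → ℕ → ℤ

InV : ℕ → ℕ → ℕ → Set
InV d i j = i + j ≤ d

δ : ℕ → ℕ → Config
δ a b i j = if ⌊ i ≟ a ⌋ ∧ ⌊ j ≟ b ⌋ then 1ℤ else 0ℤ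

splitVec : ℕ → ℕ → Config
splitVec a b i j = (ℤ.- δ a b i j) ℤ.+ δ (suc a) b i j ℤ.+ δ a (suc b) i j

data Outcome (d : ℕ) : Config → Set where
  start   : ∀ {w} → (∀ i j → w i j ≡ 0ℤ) → Outcome d w
  split   : ∀ {w w'} (a b : ℕ) → a + b < d → Outcome d w →
            (∀ i j → w' i j ≡ w i j ℤ.+ splitVec a b i j) → Outcome d w'
  unsplit : ∀ {w w'} (a b : ℕ) → a + b < d → Outcome d w →
            (∀ i j → w' i j ≡ w i j ℤ.- splitVec a b i j) → Outcome d w'

restrict : ℕ → Config → Config
restrict d' w i j with i + j Data.Nat.≤? d'
... | yes _ = w i j
... | no _  = 0ℤ

Valid : Config → Set
Valid w = ∀ i j → ¬ (i ≡ 0 × j ≡ 0) → 0ℤ ℤ.≤ w i j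

DegLe : Config → ℕ → Set
DegLe w k = ∀ i j → w i j ≢ 0ℤ → i + j ≤ k

{-# OPTIONS --safe #-}
module Submission where

-- A function F on ℕ² with F (a , b) = F (a + 1 , b) + F (a , b + 1) whenever a + b < n pairs to
-- zero with every outcome in ℤ^{V_n}; for any polynomial p the difference table F (i , j) = Δʲ p (i)
-- is such a function. Take p with roots {0, …, d'} ∖ {k} and d - ℓ₂ < t ≤ d. Its degree
-- d' + ℓ₂ ≤ d - ℓ₁ kills F on the strip j > d - ℓ₁, its roots kill F on the strip i > d - ℓ₂, and
-- in row 0 of V_{d'} it is nonzero only at (k , 0). So if w is an outcome, its restriction w' to
-- V_{d'} pairs to zero with these d' + 1 functions; as unsplitting pushes any configuration on V_{d'}
-- onto row 0, this makes w' an outcome, which is (a). For (b), w - w' is then a nonnegative outcome,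
-- and pairing it with the positive invariant 2^(d - i - j) forces it to vanish.

open import Defs
open import Data.Nat using (ℕ; _+_; _∸_; _≤_; _<_)
open import Data.Integer using (0ℤ)
open import Data.Product using (_×_)
open import Data.Sum using (_⊎_)
open import Relation.Nullary using (¬_)
open import Relation.Binary.PropositionalEquality using (_≢_)

open import Data.Nat using (zero; suc; z≤n; s≤s; _^_)
import Data.Nat.Properties as ℕ
open import Data.Integer as ℤ using (ℤ; 1ℤ; -1ℤ; +_; -[1+_])
import Data.Integer.Properties as ℤ
open import Data.Integer.Tactic.RingSolver using (solve-∀)
open import Data.List using (List; []; _∷_; _++_; length; upTo; applyUpTo)
open import Data.List.Properties using (length-++; length-applyUpTo; length-upTo)
open import Data.List.Membership.Propositional using (_∈_; _∉_)
open import Data.List.Membership.Propositional.Properties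
  using (∈-applyUpTo⁺; ∈-applyUpTo⁻; ∈-upTo⁺; ∈-upTo⁻; ∈-++⁺ˡ; ∈-++⁺ʳ; ∈-++⁻)
open import Data.List.Relation.Unary.Any using (here; there)
open import Data.Product using (_,_; proj₁; proj₂)
open import Data.Sum using (inj₁; inj₂; [_,_]′)
open import Function using (_∘_; id)
open import Relation.Nullary using (yes; no; contradiction)
open import Relation.Binary.Definitions using (tri<; tri≈; tri>)
open import Relation.Binary.PropositionalEquality
open ≡-Reasoning
open import Algebra.Properties.CommutativeSemigroup ℤ.+-commutativeSemigroup
  using () renaming (interchange to +-interchange)
open import Algebra.Properties.CommutativeSemigroup ℕ.+-commutativeSemigroup
  using () renaming (xy∙z≈xz∙y to +-rightComm)

∑ : ℕ → (ℕ → ℤ) → ℤ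
∑ zero    f = 0ℤ
∑ (suc n) f = ∑ n f ℤ.+ f n

∑-cong : ∀ n {f g} → (∀ i → i < n → f i ≡ g i) → ∑ n f ≡ ∑ n g
∑-cong zero    _ = refl
∑-cong (suc n) f≗g =
  cong₂ ℤ._+_ (∑-cong n λ i i<n → f≗g i (ℕ.m<n⇒m<1+n i<n)) (f≗g n ℕ.≤-refl)

∑-distrib-+ : ∀ n (f g : ℕ → ℤ) → ∑ n (λ i → f i ℤ.+ g i) ≡ ∑ n f ℤ.+ ∑ n g
∑-distrib-+ zero    _ _ = refl
∑-distrib-+ (suc n) f g = begin
  ∑ n (λ i → f i ℤ.+ g i) ℤ.+ (f n ℤ.+ g n) ≡⟨ cong (ℤ._+ (f n ℤ.+ g n)) (∑-distrib-+ n f g) ⟩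
  (∑ n f ℤ.+ ∑ n g) ℤ.+ (f n ℤ.+ g n)       ≡⟨ +-interchange (∑ n f) (∑ n g) (f n) (g n) ⟩
  (∑ n f ℤ.+ f n) ℤ.+ (∑ n g ℤ.+ g n)       ∎

*-distribˡ-∑ : ∀ n c (f : ℕ → ℤ) → c ℤ.* ∑ n f ≡ ∑ n (λ i → c ℤ.* f i)
*-distribˡ-∑ zero    c f = ℤ.*-zeroʳ c
*-distribˡ-∑ (suc n) c f =
  trans (ℤ.*-distribˡ-+ c (∑ n f) (f n)) (cong (ℤ._+ c ℤ.* f n) (*-distribˡ-∑ n c f))

∑-truncate : ∀ {m} n (f : ℕ → ℤ) → m ≤ n → (∀ i → m ≤ i → i < n → f i ≡ 0ℤ) → ∑ n f ≡ ∑ m f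
∑-truncate {m} n f m≤n tail≡0 with ℕ.m≤n⇒m<n∨m≡n m≤n
... | inj₂ refl = refl
∑-truncate {m} (suc n) f m≤1+n tail≡0 | inj₁ m<1+n = begin
  ∑ n f ℤ.+ f n ≡⟨ cong₂ ℤ._+_ (∑-truncate n f m≤n λ i m≤i i<n → tail≡0 i m≤i (ℕ.m<n⇒m<1+n i<n))
                               (tail≡0 n m≤n ℕ.≤-refl) ⟩
  ∑ m f ℤ.+ 0ℤ  ≡⟨ ℤ.+-identityʳ (∑ m f) ⟩
  ∑ m f         ∎
  where m≤n = ℕ.≤-pred m<1+n

∑-zero : ∀ n (f : ℕ → ℤ) → (∀ i → i < n → f i ≡ 0ℤ) → ∑ n f ≡ 0ℤ
∑-zero n f f≡0 = ∑-truncate n f z≤n (λ i _ → f≡0 i)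

∑-single : ∀ n (f : ℕ → ℤ) {k} → k < n → (∀ i → i < n → i ≢ k → f i ≡ 0ℤ) → ∑ n f ≡ f k
∑-single n f {k} k<n others≡0 = begin
  ∑ n f             ≡⟨ ∑-truncate n f k<n (λ i k<i i<n → others≡0 i i<n (ℕ.>⇒≢ k<i)) ⟩
  ∑ k f ℤ.+ f k     ≡⟨ cong (ℤ._+ f k) (∑-zero k f λ i i<k → others≡0 i (ℕ.<-trans i<k k<n) (ℕ.<⇒≢ i<k)) ⟩
  0ℤ ℤ.+ f k        ≡⟨ ℤ.+-identityˡ (f k) ⟩
  f k               ∎

∑-nonNeg : ∀ n (f : ℕ → ℤ) → (∀ i → i < n → 0ℤ ℤ.≤ f i) → 0ℤ ℤ.≤ ∑ n f
∑-nonNeg zero    _ _ = ℤ.≤-refl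
∑-nonNeg (suc n) f f≥0 =
  ℤ.+-mono-≤ (∑-nonNeg n f λ i i<n → f≥0 i (ℕ.m<n⇒m<1+n i<n)) (f≥0 n ℕ.≤-refl)

i+j≡0⇒i≡0 : ∀ {i j} → 0ℤ ℤ.≤ i → 0ℤ ℤ.≤ j → i ℤ.+ j ≡ 0ℤ → i ≡ 0ℤ
i+j≡0⇒i≡0 {+ zero}    _ _ _  = refl
i+j≡0⇒i≡0 {+ suc _} {+ _} _ _ ()

∑-nonNeg-≡0 : ∀ n (f : ℕ → ℤ) → (∀ i → i < n → 0ℤ ℤ.≤ f i) → ∑ n f ≡ 0ℤ → ∀ i → i < n → f i ≡ 0ℤ
∑-nonNeg-≡0 (suc n) f f≥0 ∑≡0 i i<1+n =
  [ (λ i<n → ∑-nonNeg-≡0 n f init≥0 ∑init≡0 i i<n) , (λ i≡n → subst (λ i → f i ≡ 0ℤ) (sym i≡n) last≡0) ]′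
    (ℕ.m≤n⇒m<n∨m≡n (ℕ.≤-pred i<1+n))
  where
  init≥0 : ∀ i → i < n → 0ℤ ℤ.≤ f i
  init≥0 i i<n = f≥0 i (ℕ.m<n⇒m<1+n i<n)
  ∑init≡0 : ∑ n f ≡ 0ℤ
  ∑init≡0 = i+j≡0⇒i≡0 (∑-nonNeg n f init≥0) (f≥0 n ℕ.≤-refl) ∑≡0
  last≡0 : f n ≡ 0ℤ
  last≡0 = i+j≡0⇒i≡0 (f≥0 n ℕ.≤-refl) (∑-nonNeg n f init≥0) (trans (ℤ.+-comm (f n) (∑ n f)) ∑≡0)

-- Pairings are summed over the square [0, n]², which contains every point touched by a split at
-- a + b < n.
∑□ : ℕ → Config → ℤ
∑□ n f = ∑ (suc n) λ i → ∑ (suc n) (f i)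

∑□-cong : ∀ n {f g : Config} → (∀ i j → i ≤ n → j ≤ n → f i j ≡ g i j) → ∑□ n f ≡ ∑□ n g
∑□-cong n f≗g =
  ∑-cong (suc n) λ i i≤n → ∑-cong (suc n) λ j j≤n → f≗g i j (ℕ.≤-pred i≤n) (ℕ.≤-pred j≤n)

∑□-distrib-+ : ∀ n (f g : Config) → ∑□ n (λ i j → f i j ℤ.+ g i j) ≡ ∑□ n f ℤ.+ ∑□ n g
∑□-distrib-+ n f g =
  trans (∑-cong (suc n) λ i _ → ∑-distrib-+ (suc n) (f i) (g i)) (∑-distrib-+ (suc n) _ _)

*-distribˡ-∑□ : ∀ n c (f : Config) → c ℤ.* ∑□ n f ≡ ∑□ n (λ i j → c ℤ.* f i j)
*-distribˡ-∑□ n c f =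
  trans (*-distribˡ-∑ (suc n) c _) (∑-cong (suc n) λ i _ → *-distribˡ-∑ (suc n) c (f i))

∑□-truncate : ∀ {m} n (f : Config) → m ≤ n → (∀ i j → m < i ⊎ m < j → f i j ≡ 0ℤ) → ∑□ n f ≡ ∑□ m f
∑□-truncate {m} n f m≤n outside≡0 = begin
  ∑ (suc n) (λ i → ∑ (suc n) (f i)) ≡⟨ ∑-truncate (suc n) _ (s≤s m≤n) (λ i m<i _ →
                                         ∑-zero (suc n) (f i) λ j _ → outside≡0 i j (inj₁ m<i)) ⟩
  ∑ (suc m) (λ i → ∑ (suc n) (f i)) ≡⟨ ∑-cong (suc m) (λ i _ → ∑-truncate (suc n) (f i) (s≤s m≤n)
                                         λ j m<j _ → outside≡0 i j (inj₂ m<j)) ⟩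
  ∑ (suc m) (λ i → ∑ (suc m) (f i)) ∎

∑□-single : ∀ n (f : Config) {a b} → a ≤ n → b ≤ n →
            (∀ i j → i ≤ n → j ≤ n → ¬ (i ≡ a × j ≡ b) → f i j ≡ 0ℤ) → ∑□ n f ≡ f a b
∑□-single n f {a} {b} a≤n b≤n others≡0 = begin
  ∑ (suc n) (λ i → ∑ (suc n) (f i)) ≡⟨ ∑-single (suc n) _ (s≤s a≤n) (λ i i≤n i≢a →
                                         ∑-zero (suc n) (f i) λ j j≤n →
                                           others≡0 i j (ℕ.≤-pred i≤n) (ℕ.≤-pred j≤n) (i≢a ∘ proj₁)) ⟩
  ∑ (suc n) (f a)                   ≡⟨ ∑-single (suc n) (f a) (s≤s b≤n) (λ j j≤n j≢b →
                                         others≡0 a j a≤n (ℕ.≤-pred j≤n) (j≢b ∘ proj₂)) ⟩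
  f a b                             ∎

∑□-nonNeg-≡0 : ∀ n (f : Config) → (∀ i j → i ≤ n → j ≤ n → 0ℤ ℤ.≤ f i j) → ∑□ n f ≡ 0ℤ →
               ∀ i j → i ≤ n → j ≤ n → f i j ≡ 0ℤ
∑□-nonNeg-≡0 n f f≥0 ∑□≡0 i j i≤n j≤n =
  ∑-nonNeg-≡0 (suc n) (f i) (row≥0 i≤n) (rowSum≡0 i (s≤s i≤n)) j (s≤s j≤n)
  where
  row≥0 : ∀ {i} → i ≤ n → ∀ j → j < suc n → 0ℤ ℤ.≤ f i j
  row≥0 i≤n j j<1+n = f≥0 _ j i≤n (ℕ.≤-pred j<1+n)
  rowSum≡0 : ∀ i → i < suc n → ∑ (suc n) (f i) ≡ 0ℤ
  rowSum≡0 = ∑-nonNeg-≡0 (suc n) _ (λ i i<1+n → ∑-nonNeg (suc n) (f i) (row≥0 (ℕ.≤-pred i<1+n))) ∑□≡0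

-- Moves and split-invariant functions

δ-diag : ∀ a b → δ a b a b ≡ 1ℤ
δ-diag a b with a ℕ.≟ a | b ℕ.≟ b
... | yes _   | yes _   = refl
... | yes _   | no b≢b  = contradiction refl b≢b
... | no a≢a  | _       = contradiction refl a≢a

δ-off : ∀ {a b i j} → ¬ (i ≡ a × j ≡ b) → δ a b i j ≡ 0ℤ
δ-off {a} {b} {i} {j} ≢ab with i ℕ.≟ a | j ℕ.≟ b
... | yes i≡a | yes j≡b = contradiction (i≡a , j≡b) ≢ab
... | yes _   | no _    = refl
... | no _    | _       = refl

splitVec-upper : ∀ {a b i j} → b < j → splitVec a b i j ≡ δ a (suc b) i j
splitVec-upper {a} {b} {i} {j} b<j
  rewrite δ-off {a} {b} {i} {j} (ℕ.>⇒≢ b<j ∘ proj₂) | δ-off {suc a} {b} {i} {j} (ℕ.>⇒≢ b<j ∘ proj₂)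
  = ℤ.+-identityˡ (δ a (suc b) i j)

splitVec-upper-off : ∀ {a b i} → i ≢ a → splitVec a b i (suc b) ≡ 0ℤ
splitVec-upper-off {b = b} i≢a = trans (splitVec-upper (ℕ.n<1+n b)) (δ-off (i≢a ∘ proj₁))

splitVec-beyond : ∀ {n a b i j} → a + b < n → n < i + j → splitVec a b i j ≡ 0ℤ
splitVec-beyond {n} {a} {b} {i} {j} a+b<n n<i+j =
  cong₂ ℤ._+_ (cong₂ ℤ._+_ (cong ℤ.-_ (δ-off (beyond a b (ℕ.<-trans a+b<n n<i+j))))
                           (δ-off (beyond (suc a) b (ℕ.≤-<-trans a+b<n n<i+j))))
              (δ-off (beyond a (suc b) (subst (_< i + j) (sym (ℕ.+-suc a b)) (ℕ.≤-<-trans a+b<n n<i+j))))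
  where
  beyond : ∀ x y → x + y < i + j → ¬ (i ≡ x × j ≡ y)
  beyond x y x+y<i+j (refl , refl) = ℕ.<-irrefl refl x+y<i+j

_⊙_ : Config → Config → Config
(w ⊙ F) i j = w i j ℤ.* F i j

addMove : ℤ → ℕ → ℕ → Config → Config
addMove c a b w i j = w i j ℤ.+ c ℤ.* splitVec a b i j

SplitInvariant : ℕ → Config → Set
SplitInvariant n F = ∀ a b → a + b < n → F a b ≡ F (suc a) b ℤ.+ F a (suc b)

∑□-δ : ∀ n (F : Config) {a b} → a ≤ n → b ≤ n → ∑□ n (δ a b ⊙ F) ≡ F a b
∑□-δ n F {a} {b} a≤n b≤n =
  trans (∑□-single n (δ a b ⊙ F) a≤n b≤n λ i j _ _ ≢ab → cong (ℤ._* F i j) (δ-off ≢ab))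
        (trans (cong (ℤ._* F a b) (δ-diag a b)) (ℤ.*-identityˡ (F a b)))

∑□-splitVec : ∀ n {F} → SplitInvariant n F → ∀ {a b} → a + b < n → ∑□ n (splitVec a b ⊙ F) ≡ 0ℤ
∑□-splitVec n {F} F-inv {a} {b} a+b<n = begin
  ∑□ n (splitVec a b ⊙ F)
    ≡⟨ ∑□-cong n (λ i j _ _ → expand (δ a b i j) (δ (suc a) b i j) (δ a (suc b) i j) (F i j)) ⟩
  ∑□ n (λ i j → (-1ℤ ℤ.* (δ a b ⊙ F) i j ℤ.+ (δ (suc a) b ⊙ F) i j) ℤ.+ (δ a (suc b) ⊙ F) i j)
    ≡⟨ trans (∑□-distrib-+ n _ _) (cong (ℤ._+ ∑□ n (δ a (suc b) ⊙ F)) (∑□-distrib-+ n _ _)) ⟩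
  (∑□ n (λ i j → -1ℤ ℤ.* (δ a b ⊙ F) i j) ℤ.+ ∑□ n (δ (suc a) b ⊙ F)) ℤ.+ ∑□ n (δ a (suc b) ⊙ F)
    ≡⟨ cong₂ ℤ._+_ (cong₂ ℤ._+_ (trans (sym (*-distribˡ-∑□ n -1ℤ _))
                                       (cong (-1ℤ ℤ.*_) (∑□-δ n F (ℕ.<⇒≤ a<n) (ℕ.<⇒≤ b<n))))
                                (∑□-δ n F a<n (ℕ.<⇒≤ b<n)))
                   (∑□-δ n F (ℕ.<⇒≤ a<n) b<n) ⟩
  (-1ℤ ℤ.* F a b ℤ.+ F (suc a) b) ℤ.+ F a (suc b)
    ≡⟨ cong (λ x → (-1ℤ ℤ.* x ℤ.+ F (suc a) b) ℤ.+ F a (suc b)) (F-inv a b a+b<n) ⟩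
  (-1ℤ ℤ.* (F (suc a) b ℤ.+ F a (suc b)) ℤ.+ F (suc a) b) ℤ.+ F a (suc b)
    ≡⟨ cancel (F (suc a) b) (F a (suc b)) ⟩
  0ℤ ∎
  where
  expand : ∀ x y z f → (ℤ.- x ℤ.+ y ℤ.+ z) ℤ.* f ≡ (-1ℤ ℤ.* (x ℤ.* f) ℤ.+ y ℤ.* f) ℤ.+ z ℤ.* f
  expand = solve-∀
  cancel : ∀ y z → (-1ℤ ℤ.* (y ℤ.+ z) ℤ.+ y) ℤ.+ z ≡ 0ℤ
  cancel = solve-∀
  a<n : a < n
  a<n = ℕ.≤-<-trans (ℕ.m≤m+n a b) a+b<n
  b<n : b < n
  b<n = ℕ.≤-<-trans (ℕ.m≤n+m b a) a+b<n

∑□-zero : ∀ n (f : Config) → (∀ i j → f i j ≡ 0ℤ) → ∑□ n f ≡ 0ℤ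
∑□-zero n f f≡0 = ∑-zero (suc n) _ λ i _ → ∑-zero (suc n) (f i) λ j _ → f≡0 i j

∑□-addMove : ∀ n {F} → SplitInvariant n F → ∀ {a b} → a + b < n → ∀ c w →
             ∑□ n (addMove c a b w ⊙ F) ≡ ∑□ n (w ⊙ F)
∑□-addMove n {F} F-inv {a} {b} a+b<n c w = begin
  ∑□ n (addMove c a b w ⊙ F)
    ≡⟨ ∑□-cong n (λ i j _ _ → distrib (w i j) c (splitVec a b i j) (F i j)) ⟩
  ∑□ n (λ i j → (w ⊙ F) i j ℤ.+ c ℤ.* (splitVec a b ⊙ F) i j)
    ≡⟨ ∑□-distrib-+ n _ _ ⟩
  ∑□ n (w ⊙ F) ℤ.+ ∑□ n (λ i j → c ℤ.* (splitVec a b ⊙ F) i j)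
    ≡⟨ cong (ℤ._+_ (∑□ n (w ⊙ F))) (sym (*-distribˡ-∑□ n c _)) ⟩
  ∑□ n (w ⊙ F) ℤ.+ c ℤ.* ∑□ n (splitVec a b ⊙ F)
    ≡⟨ cong (λ s → ∑□ n (w ⊙ F) ℤ.+ c ℤ.* s) (∑□-splitVec n F-inv a+b<n) ⟩
  ∑□ n (w ⊙ F) ℤ.+ c ℤ.* 0ℤ
    ≡⟨ cong (ℤ._+_ (∑□ n (w ⊙ F))) (ℤ.*-zeroʳ c) ⟩
  ∑□ n (w ⊙ F) ℤ.+ 0ℤ
    ≡⟨ ℤ.+-identityʳ _ ⟩
  ∑□ n (w ⊙ F) ∎
  where
  distrib : ∀ x c s f → (x ℤ.+ c ℤ.* s) ℤ.* f ≡ x ℤ.* f ℤ.+ c ℤ.* (s ℤ.* f)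
  distrib = solve-∀

∑□-outcome : ∀ n {F} → SplitInvariant n F → ∀ {w} → Outcome n w → ∑□ n (w ⊙ F) ≡ 0ℤ
∑□-outcome n {F} F-inv (start w≡0) = ∑□-zero n _ λ i j → cong (ℤ._* F i j) (w≡0 i j)
∑□-outcome n {F} F-inv (split {w} {w'} a b a+b<n o w'≡) = begin
  ∑□ n (w' ⊙ F)               ≡⟨ ∑□-cong n (λ i j _ _ →
                                   cong (ℤ._* F i j) (trans (w'≡ i j) (plusOne (w i j) _))) ⟩
  ∑□ n (addMove 1ℤ a b w ⊙ F) ≡⟨ ∑□-addMove n F-inv a+b<n 1ℤ w ⟩
  ∑□ n (w ⊙ F)                ≡⟨ ∑□-outcome n F-inv o ⟩
  0ℤ                          ∎
  where
  plusOne : ∀ x s → x ℤ.+ s ≡ x ℤ.+ 1ℤ ℤ.* s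
  plusOne = solve-∀
∑□-outcome n {F} F-inv (unsplit {w} {w'} a b a+b<n o w'≡) = begin
  ∑□ n (w' ⊙ F)                ≡⟨ ∑□-cong n (λ i j _ _ →
                                    cong (ℤ._* F i j) (trans (w'≡ i j) (minusOne (w i j) _))) ⟩
  ∑□ n (addMove -1ℤ a b w ⊙ F) ≡⟨ ∑□-addMove n F-inv a+b<n -1ℤ w ⟩
  ∑□ n (w ⊙ F)                 ≡⟨ ∑□-outcome n F-inv o ⟩
  0ℤ                           ∎
  where
  minusOne : ∀ x s → x ℤ.- s ≡ x ℤ.+ -1ℤ ℤ.* s
  minusOne = solve-∀

Outcome-cong : ∀ {n w w'} → (∀ i j → w' i j ≡ w i j) → Outcome n w → Outcome n w'
Outcome-cong w'≗w (start w≡0)        = start λ i j → trans (w'≗w i j) (w≡0 i j)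
Outcome-cong w'≗w (split a b lt o eq)   = split a b lt o λ i j → trans (w'≗w i j) (eq i j)
Outcome-cong w'≗w (unsplit a b lt o eq) = unsplit a b lt o λ i j → trans (w'≗w i j) (eq i j)

Outcome-mono : ∀ {n m w} → n ≤ m → Outcome n w → Outcome m w
Outcome-mono _   (start w≡0)           = start w≡0
Outcome-mono n≤m (split a b lt o eq)   = split a b (ℕ.<-≤-trans lt n≤m) (Outcome-mono n≤m o) eq
Outcome-mono n≤m (unsplit a b lt o eq) = unsplit a b (ℕ.<-≤-trans lt n≤m) (Outcome-mono n≤m o) eq

Outcome-supported : ∀ {n w} → Outcome n w → ∀ i j → n < i + j → w i j ≡ 0ℤ
Outcome-supported (start w≡0) i j _ = w≡0 i j
Outcome-supported (split a b lt o eq) i j n<i+j =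
  trans (eq i j) (cong₂ ℤ._+_ (Outcome-supported o i j n<i+j) (splitVec-beyond {a = a} {b} {i} {j} lt n<i+j))
Outcome-supported (unsplit a b lt o eq) i j n<i+j =
  trans (eq i j) (cong₂ ℤ._-_ (Outcome-supported o i j n<i+j) (splitVec-beyond {a = a} {b} {i} {j} lt n<i+j))

Outcome-addMove : ∀ {n a b w} → a + b < n → Outcome n w → ∀ c → Outcome n (addMove c a b w)
Outcome-addMove {n} {a} {b} {w} a+b<n o (+ k) = splits k
  where
  splits : ∀ k → Outcome n (addMove (+ k) a b w)
  splits zero    = Outcome-cong (λ i j → ℤ.+-identityʳ (w i j)) o
  splits (suc k) = split a b a+b<n (splits k) λ i j → step (w i j) (splitVec a b i j) (+ k)
    where
    step : ∀ x s k → x ℤ.+ (1ℤ ℤ.+ k) ℤ.* s ≡ (x ℤ.+ k ℤ.* s) ℤ.+ s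
    step = solve-∀
Outcome-addMove {n} {a} {b} {w} a+b<n o -[1+ k ] = unsplits (suc k)
  where
  unsplits : ∀ k → Outcome n (addMove (ℤ.- + k) a b w)
  unsplits zero    = Outcome-cong (λ i j → ℤ.+-identityʳ (w i j)) o
  unsplits (suc k) = unsplit a b a+b<n (unsplits k) λ i j → step (w i j) (splitVec a b i j) (+ k)
    where
    step : ∀ x s k → x ℤ.+ (ℤ.- (1ℤ ℤ.+ k)) ℤ.* s ≡ (x ℤ.+ (ℤ.- k) ℤ.* s) ℤ.- s
    step = solve-∀

Outcome-addMove⁻ : ∀ {n a b w} → a + b < n → ∀ c → Outcome n (addMove c a b w) → Outcome n w
Outcome-addMove⁻ {w = w} a+b<n c o =
  Outcome-cong (λ i j → undo (w i j) c (splitVec _ _ i j)) (Outcome-addMove a+b<n o (ℤ.- c))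
  where
  undo : ∀ x c s → x ≡ (x ℤ.+ c ℤ.* s) ℤ.+ (ℤ.- c) ℤ.* s
  undo = solve-∀

-- Pushing a configuration onto row 0

addRowMoves : (ℕ → ℤ) → ℕ → ℕ → Config → Config
addRowMoves c b zero    w = w
addRowMoves c b (suc m) w = addMove (c m) m b (addRowMoves c b m w)

addRowMoves-off : ∀ c b m w {i j} → (∀ a → a < m → splitVec a b i j ≡ 0ℤ) →
                  addRowMoves c b m w i j ≡ w i j
addRowMoves-off _ _ zero    _ _ = refl
addRowMoves-off c b (suc m) w {i} {j} s≡0 = begin
  addRowMoves c b m w i j ℤ.+ c m ℤ.* splitVec m b i j
    ≡⟨ cong₂ (λ x y → x ℤ.+ c m ℤ.* y) (addRowMoves-off c b m w λ a a<m → s≡0 a (ℕ.m<n⇒m<1+n a<m))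
                                        (s≡0 m ℕ.≤-refl) ⟩
  w i j ℤ.+ c m ℤ.* 0ℤ
    ≡⟨ cong (ℤ._+_ (w i j)) (ℤ.*-zeroʳ (c m)) ⟩
  w i j ℤ.+ 0ℤ
    ≡⟨ ℤ.+-identityʳ (w i j) ⟩
  w i j ∎

addRowMoves-upper : ∀ c b m w {i} → i < m → addRowMoves c b m w i (suc b) ≡ w i (suc b) ℤ.+ c i
addRowMoves-upper c b (suc m) w {i} i<1+m with ℕ.m≤n⇒m<n∨m≡n (ℕ.≤-pred i<1+m)
... | inj₁ i<m = begin
  addRowMoves c b m w i (suc b) ℤ.+ c m ℤ.* splitVec m b i (suc b)
    ≡⟨ cong₂ (λ x y → x ℤ.+ c m ℤ.* y) (addRowMoves-upper c b m w i<m) (splitVec-upper-off (ℕ.<⇒≢ i<m)) ⟩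
  (w i (suc b) ℤ.+ c i) ℤ.+ c m ℤ.* 0ℤ
    ≡⟨ trans (cong (ℤ._+_ (w i (suc b) ℤ.+ c i)) (ℤ.*-zeroʳ (c m))) (ℤ.+-identityʳ _) ⟩
  w i (suc b) ℤ.+ c i ∎
... | inj₂ refl = begin
  addRowMoves c b i w i (suc b) ℤ.+ c i ℤ.* splitVec i b i (suc b)
    ≡⟨ cong₂ (λ x y → x ℤ.+ c i ℤ.* y) (addRowMoves-off c b i w λ a a<i → splitVec-upper-off (ℕ.>⇒≢ a<i))
                                        (trans (splitVec-upper (ℕ.n<1+n b)) (δ-diag i (suc b))) ⟩
  w i (suc b) ℤ.+ c i ℤ.* 1ℤ
    ≡⟨ cong (ℤ._+_ (w i (suc b))) (ℤ.*-identityʳ (c i)) ⟩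
  w i (suc b) ℤ.+ c i ∎

Outcome-addRowMoves⁻ : ∀ {n c b} m {w} → (∀ a → a < m → a + b < n) →
                       Outcome n (addRowMoves c b m w) → Outcome n w
Outcome-addRowMoves⁻ zero    _ o = o
Outcome-addRowMoves⁻ {c = c} (suc m) legal o =
  Outcome-addRowMoves⁻ m (λ a a<m → legal a (ℕ.m<n⇒m<1+n a<m)) (Outcome-addMove⁻ (legal m ℕ.≤-refl) (c m) o)

∑□-addRowMoves : ∀ n {F} → SplitInvariant n F → ∀ c b m w → (∀ a → a < m → a + b < n) →
                 ∑□ n (addRowMoves c b m w ⊙ F) ≡ ∑□ n (w ⊙ F)
∑□-addRowMoves _ _ _ _ zero    _ _ = refl
∑□-addRowMoves n F-inv c b (suc m) w legal =
  trans (∑□-addMove n F-inv (legal m ℕ.≤-refl) (c m) (addRowMoves c b m w))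
        (∑□-addRowMoves n F-inv c b m w λ a a<m → legal a (ℕ.m<n⇒m<1+n a<m))

SupportedIn : ℕ → Config → Set
SupportedIn n w = ∀ i j → n < i + j → w i j ≡ 0ℤ

ZeroAbove : ℕ → Config → Set
ZeroAbove b w = ∀ i j → b < j → w i j ≡ 0ℤ

clearRow : ℕ → ℕ → Config → Config
clearRow n b u = addRowMoves (λ a → ℤ.- u a (suc b)) b (n ∸ b) u

clearRow-legal : ∀ n b a → a < n ∸ b → a + b < n
clearRow-legal n b a a<n∸b = ℕ.m≤o∸n⇒m+n≤o (suc a) b≤n a<n∸b
  where
  b≤n : b ≤ n
  b≤n = ℕ.<⇒≤ (ℕ.m∸n≢0⇒n<m (ℕ.>⇒≢ (ℕ.≤-<-trans z≤n a<n∸b)))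

clearRow-supported : ∀ n b {u} → SupportedIn n u → SupportedIn n (clearRow n b u)
clearRow-supported n b {u} u-supp i j n<i+j =
  trans (addRowMoves-off _ b (n ∸ b) u λ a a<n∸b →
           splitVec-beyond {a = a} {b} {i} {j} (clearRow-legal n b a a<n∸b) n<i+j)
        (u-supp i j n<i+j)

clearRow-zeroAbove : ∀ n b {u} → SupportedIn n u → ZeroAbove (suc b) u → ZeroAbove b (clearRow n b u)
clearRow-zeroAbove n b {u} u-supp u-above i j b<j with ℕ.m≤n⇒m<n∨m≡n b<j
... | inj₁ 1+b<j =
  trans (addRowMoves-off _ b (n ∸ b) u λ a _ →
           trans (splitVec-upper {a} {b} {i} {j} b<j) (δ-off (ℕ.>⇒≢ 1+b<j ∘ proj₂)))
        (u-above i j 1+b<j)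
... | inj₂ refl with i ℕ.<? n ∸ b
...   | yes i<n∸b = trans (addRowMoves-upper _ b (n ∸ b) u i<n∸b) (ℤ.+-inverseʳ (u i (suc b)))
...   | no  i≮n∸b =
  trans (addRowMoves-off _ b (n ∸ b) u λ a a<n∸b →
           splitVec-upper-off (ℕ.>⇒≢ (ℕ.<-≤-trans a<n∸b (ℕ.≮⇒≥ i≮n∸b))))
        (u-supp i (suc b) n<i+1+b)
  where
  n<i+1+b : n < i + suc b
  n<i+1+b = ℕ.≤-trans (s≤s (ℕ.≤-trans (ℕ.m≤n+m∸n n b) (ℕ.+-monoʳ-≤ b (ℕ.≮⇒≥ i≮n∸b))))
                      (ℕ.≤-reflexive (ℕ.+-comm (suc b) i))

Separating : ℕ → (ℕ → Config) → Set
Separating n F = ∀ k → k ≤ n → F k k 0 ≢ 0ℤ × (∀ i → i ≤ n → i ≢ k → F k i 0 ≡ 0ℤ)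

Annihilates : ℕ → (ℕ → Config) → Config → Set
Annihilates n F u = ∀ k → k ≤ n → ∑□ n (u ⊙ F k) ≡ 0ℤ

annihilated-bottomRow-≡0 : ∀ n {F u} → Separating n F → SupportedIn n u → ZeroAbove 0 u →
                            Annihilates n F u → ∀ i j → u i j ≡ 0ℤ
annihilated-bottomRow-≡0 n _ _ u-above _ i (suc j) = u-above i (suc j) (s≤s z≤n)
annihilated-bottomRow-≡0 n {F} {u} F-sep u-supp u-above u⊥F i zero with i ℕ.≤? n
... | no  i≰n = u-supp i 0 (ℕ.<-≤-trans (ℕ.≰⇒> i≰n) (ℕ.m≤m+n i 0))
... | yes i≤n with ℤ.i*j≡0⇒i≡0∨j≡0 (u i 0) u⊙F≡0
  where
  others≡0 : ∀ i' j' → i' ≤ n → j' ≤ n → ¬ (i' ≡ i × j' ≡ 0) → (u ⊙ F i) i' j' ≡ 0ℤ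
  others≡0 i' (suc j') _ _ _  = cong (ℤ._* F i i' (suc j')) (u-above i' (suc j') (s≤s z≤n))
  others≡0 i' zero i'≤n _ ≢i0 =
    trans (cong (u i' 0 ℤ.*_) (proj₂ (F-sep i i≤n) i' i'≤n λ i'≡i → ≢i0 (i'≡i , refl))) (ℤ.*-zeroʳ (u i' 0))
  u⊙F≡0 : u i 0 ℤ.* F i i 0 ≡ 0ℤ
  u⊙F≡0 = trans (sym (∑□-single n (u ⊙ F i) i≤n z≤n others≡0)) (u⊥F i i≤n)
...   | inj₁ u≡0 = u≡0
...   | inj₂ F≡0 = contradiction F≡0 (proj₁ (F-sep i i≤n))

outcome-of-annihilated : ∀ n {F} → (∀ k → SplitInvariant n (F k)) → Separating n F →
                         ∀ {u} → SupportedIn n u → Annihilates n F u → Outcome n u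
outcome-of-annihilated n {F} F-inv F-sep u-supp =
  lower n u-supp λ i j n<j → u-supp i j (ℕ.<-≤-trans n<j (ℕ.m≤n+m j i))
  where
  lower : ∀ b {u} → SupportedIn n u → ZeroAbove b u → Annihilates n F u → Outcome n u
  lower zero    u-supp u-above u⊥F = start (annihilated-bottomRow-≡0 n F-sep u-supp u-above u⊥F)
  lower (suc b) {u} u-supp u-above u⊥F =
    Outcome-addRowMoves⁻ (n ∸ b) (clearRow-legal n b)
      (lower b (clearRow-supported n b u-supp) (clearRow-zeroAbove n b u-supp u-above) λ k k≤n →
        trans (∑□-addRowMoves n (F-inv k) _ b (n ∸ b) u (clearRow-legal n b)) (u⊥F k k≤n))

-- Difference tables of polynomials

-- The sign (p n - p (n + 1)) is what makes differenceTable split-invariant.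
Δ^ : ℕ → (ℕ → ℤ) → ℕ → ℤ
Δ^ zero    p n = p n
Δ^ (suc j) p n = Δ^ j p n ℤ.- Δ^ j p (suc n)

differenceTable : (ℕ → ℤ) → Config
differenceTable p i j = Δ^ j p i

differenceTable-splitInvariant : ∀ n p → SplitInvariant n (differenceTable p)
differenceTable-splitInvariant n p a b _ = telescope (Δ^ b p a) (Δ^ b p (suc a))
  where
  telescope : ∀ x y → x ≡ y ℤ.+ (x ℤ.- y)
  telescope = solve-∀

Δ^-vanishes : ∀ j p i → (∀ m → i ≤ m → m ≤ i + j → p m ≡ 0ℤ) → Δ^ j p i ≡ 0ℤ
Δ^-vanishes zero    p i p≡0 = p≡0 i ℕ.≤-refl (ℕ.m≤m+n i 0)
Δ^-vanishes (suc j) p i p≡0 =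
  cong₂ ℤ._-_ (Δ^-vanishes j p i λ m i≤m m≤i+j →
                 p≡0 m i≤m (ℕ.≤-trans m≤i+j (ℕ.+-monoʳ-≤ i (ℕ.n≤1+n j))))
              (Δ^-vanishes j p (suc i) λ m i<m m≤1+i+j →
                 p≡0 m (ℕ.<⇒≤ i<m) (ℕ.≤-trans m≤1+i+j (ℕ.≤-reflexive (sym (ℕ.+-suc i j)))))

Degree≤ : ℕ → (ℕ → ℤ) → Set
Degree≤ m p = ∀ j → m < j → ∀ n → Δ^ j p n ≡ 0ℤ

Degree≤-const : ∀ c → Degree≤ 0 (λ _ → c)
Degree≤-const c (suc zero)    _ _ = ℤ.+-inverseʳ c
Degree≤-const c (suc (suc j)) _ n =
  cong₂ ℤ._-_ (Degree≤-const c (suc j) (s≤s z≤n) n) (Degree≤-const c (suc j) (s≤s z≤n) (suc n))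

Δ^-linearFactor : ∀ t g j n →
  Δ^ (suc j) (λ m → (+ m ℤ.- + t) ℤ.* g m) n ≡ (+ n ℤ.- + t) ℤ.* Δ^ (suc j) g n ℤ.- + suc j ℤ.* Δ^ j g (suc n)
Δ^-linearFactor t g zero n = base (+ n) (+ t) (g n) (g (suc n))
  where
  base : ∀ x t g₀ g₁ →
    (x ℤ.- t) ℤ.* g₀ ℤ.- ((1ℤ ℤ.+ x) ℤ.- t) ℤ.* g₁ ≡ (x ℤ.- t) ℤ.* (g₀ ℤ.- g₁) ℤ.- 1ℤ ℤ.* g₁
  base = solve-∀
Δ^-linearFactor t g (suc j) n
  rewrite Δ^-linearFactor t g j n | Δ^-linearFactor t g j (suc n) =
  step (+ n) (+ t) (Δ^ (suc j) g n) (Δ^ j g (suc n)) (Δ^ j g (suc (suc n))) (+ suc j)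
  where
  step : ∀ x t d₀ e₁ e₂ k →
    ((x ℤ.- t) ℤ.* d₀ ℤ.- k ℤ.* e₁) ℤ.- (((1ℤ ℤ.+ x) ℤ.- t) ℤ.* (e₁ ℤ.- e₂) ℤ.- k ℤ.* e₂)
      ≡ (x ℤ.- t) ℤ.* (d₀ ℤ.- (e₁ ℤ.- e₂)) ℤ.- (1ℤ ℤ.+ k) ℤ.* (e₁ ℤ.- e₂)
  step = solve-∀

Degree≤-linearFactor : ∀ {m} t g → Degree≤ m g → Degree≤ (suc m) (λ n → (+ n ℤ.- + t) ℤ.* g n)
Degree≤-linearFactor t g g≤m (suc j) (s≤s m<j) n
  rewrite Δ^-linearFactor t g j n | g≤m (suc j) (ℕ.m<n⇒m<1+n m<j) n | g≤m j m<j (suc n)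
  = cong₂ ℤ._-_ (ℤ.*-zeroʳ (+ n ℤ.- + t)) (ℤ.*-zeroʳ (+ suc j))

rootPoly : List ℕ → ℕ → ℤ
rootPoly []       _ = 1ℤ
rootPoly (t ∷ ts) n = (+ n ℤ.- + t) ℤ.* rootPoly ts n

Degree≤-rootPoly : ∀ ts → Degree≤ (length ts) (rootPoly ts)
Degree≤-rootPoly []       = Degree≤-const 1ℤ
Degree≤-rootPoly (t ∷ ts) = Degree≤-linearFactor t (rootPoly ts) (Degree≤-rootPoly ts)

rootPoly-root : ∀ {ts t} → t ∈ ts → rootPoly ts t ≡ 0ℤ
rootPoly-root {t ∷ ts} (here refl) = cong (ℤ._* rootPoly ts t) (ℤ.+-inverseʳ (+ t))
rootPoly-root {u ∷ ts} {t} (there t∈ts) =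
  trans (cong ((+ t ℤ.- + u) ℤ.*_) (rootPoly-root t∈ts)) (ℤ.*-zeroʳ (+ t ℤ.- + u))

rootPoly-nonroot : ∀ {ts n} → n ∉ ts → rootPoly ts n ≢ 0ℤ
rootPoly-nonroot {[]}     _ ()
rootPoly-nonroot {t ∷ ts} {n} n∉ts p≡0 with ℤ.i*j≡0⇒i≡0∨j≡0 (+ n ℤ.- + t) p≡0
... | inj₁ n-t≡0 = n∉ts (here (ℤ.+-injective (ℤ.i-j≡0⇒i≡j (+ n) (+ t) n-t≡0)))
... | inj₂ p≡0'  = rootPoly-nonroot (n∉ts ∘ there) p≡0'

interval : ℕ → ℕ → List ℕ
interval a l = applyUpTo (_+_ a) l

∈-interval⁺ : ∀ {a l m} → a ≤ m → m < a + l → m ∈ interval a l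
∈-interval⁺ {a} {l} {m} a≤m m<a+l =
  subst (_∈ interval a l) (ℕ.m+[n∸m]≡n a≤m)
        (∈-applyUpTo⁺ (_+_ a) (subst (m ∸ a <_) (ℕ.m+n∸m≡n a l) (ℕ.∸-monoˡ-< m<a+l a≤m)))

∈-interval⁻ : ∀ {a l m} → m ∈ interval a l → a ≤ m × m < a + l
∈-interval⁻ {a} m∈ with ∈-applyUpTo⁻ (_+_ a) m∈
... | i , i<l , refl = ℕ.m≤m+n a i , ℕ.+-monoʳ-< a i<l

length-interval : ∀ a l → length (interval a l) ≡ l
length-interval a = length-applyUpTo (_+_ a)

-- Restriction to V_{d'} and valid outcomes

restrict-≤ : ∀ {d'} w i j → i + j ≤ d' → restrict d' w i j ≡ w i j
restrict-≤ {d'} w i j i+j≤d' with i + j ℕ.≤? d'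
... | yes _     = refl
... | no  i+j≰d' = contradiction i+j≤d' i+j≰d'

restrict-> : ∀ {d'} w i j → d' < i + j → restrict d' w i j ≡ 0ℤ
restrict-> {d'} w i j d'<i+j with i + j ℕ.≤? d'
... | yes i+j≤d' = contradiction i+j≤d' (ℕ.<⇒≱ d'<i+j)
... | no  _     = refl

twoPowers : ℕ → Config
twoPowers n i j = + 2 ^ (n ∸ (i + j))

twoPowers-splitInvariant : ∀ n → SplitInvariant n (twoPowers n)
twoPowers-splitInvariant n a b a+b<n
  rewrite ℕ.+-suc a b | ℕ.+-∸-assoc 1 a+b<n
  = cong (λ x → + (2 ^ (n ∸ suc (a + b)) + x)) (ℕ.+-identityʳ _)

twoPowers-≢0 : ∀ n i j → twoPowers n i j ≢ 0ℤ
twoPowers-≢0 n i j eq = ℕ.<⇒≢ (ℕ.m^n>0 2 (n ∸ (i + j))) (sym (ℤ.+-injective eq))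

Outcome-sub : ∀ {n w u} → Outcome n w → Outcome n u → Outcome n (λ i j → w i j ℤ.- u i j)
Outcome-sub {w = w} w-out (start u≡0) =
  Outcome-cong (λ i j → trans (cong (ℤ._-_ (w i j)) (u≡0 i j)) (ℤ.+-identityʳ (w i j))) w-out
Outcome-sub {w = w} w-out (split {u} a b lt o eq) =
  unsplit a b lt (Outcome-sub w-out o) λ i j →
    trans (cong (ℤ._-_ (w i j)) (eq i j)) (minusSum (w i j) (u i j) (splitVec a b i j))
  where
  minusSum : ∀ x y s → x ℤ.- (y ℤ.+ s) ≡ (x ℤ.- y) ℤ.- s
  minusSum = solve-∀
Outcome-sub {w = w} w-out (unsplit {u} a b lt o eq) =
  split a b lt (Outcome-sub w-out o) λ i j →
    trans (cong (ℤ._-_ (w i j)) (eq i j)) (minusDifference (w i j) (u i j) (splitVec a b i j))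
  where
  minusDifference : ∀ x y s → x ℤ.- (y ℤ.- s) ≡ (x ℤ.- y) ℤ.+ s
  minusDifference = solve-∀

nonNeg-outcome-≡0 : ∀ {n v} → (∀ i j → 0ℤ ℤ.≤ v i j) → Outcome n v → ∀ i j → v i j ≡ 0ℤ
nonNeg-outcome-≡0 {n} {v} v≥0 v-out i j with ℕ.≤-<-connex (i + j) n
... | inj₂ n<i+j = Outcome-supported v-out i j n<i+j
... | inj₁ i+j≤n =
  [ id , (λ G≡0 → contradiction G≡0 (twoPowers-≢0 n i j)) ]′ (ℤ.i*j≡0⇒i≡0∨j≡0 (v i j)
    (∑□-nonNeg-≡0 n (v ⊙ twoPowers n) (λ i j _ _ → ℤ.*-monoʳ-≤-nonNeg (twoPowers n i j) (v≥0 i j))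
                  (∑□-outcome n (twoPowers-splitInvariant n) v-out)
                  i j (ℕ.≤-trans (ℕ.m≤m+n i j) i+j≤n) (ℕ.≤-trans (ℕ.m≤n+m j i) i+j≤n)))

valid-outcome-degree : ∀ {d d' w} → Outcome d w → Outcome d (restrict d' w) → Valid w → DegLe w d'
valid-outcome-degree {d} {d'} {w} w-out u-out w-valid i j w≢0 with ℕ.≤-<-connex (i + j) d'
... | inj₁ i+j≤d' = i+j≤d'
... | inj₂ d'<i+j =
  contradiction (trans (sym (w-u≡w d'<i+j)) (nonNeg-outcome-≡0 w-u≥0 (Outcome-sub w-out u-out) i j)) w≢0
  where
  w-u≡w : ∀ {i j} → d' < i + j → w i j ℤ.- restrict d' w i j ≡ w i j
  w-u≡w {i} {j} d'<i+j = trans (cong (ℤ._-_ (w i j)) (restrict-> w i j d'<i+j)) (ℤ.+-identityʳ (w i j))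

  w-u≥0 : ∀ i j → 0ℤ ℤ.≤ w i j ℤ.- restrict d' w i j
  w-u≥0 i j with ℕ.≤-<-connex (i + j) d'
  ... | inj₁ i+j≤d' =
    ℤ.≤-reflexive (sym (trans (cong (ℤ._-_ (w i j)) (restrict-≤ w i j i+j≤d')) (ℤ.+-inverseʳ (w i j))))
  ... | inj₂ d'<i+j =
    subst (0ℤ ℤ.≤_) (sym (w-u≡w d'<i+j)) (w-valid i j λ { (refl , refl) → ℕ.<⇒≱ d'<i+j z≤n })

module StripInvariants (d d' ℓ₁ ℓ₂ : ℕ) (d'+ℓ₁+ℓ₂≤d : d' + ℓ₁ + ℓ₂ ≤ d) where

  roots : ℕ → List ℕ
  roots k = upTo k ++ interval (suc k) (d' ∸ k) ++ interval (suc (d ∸ ℓ₂)) ℓ₂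

  F : ℕ → Config
  F k = differenceTable (rootPoly (roots k))

  private
    d'+ℓ₂≤d : d' + ℓ₂ ≤ d
    d'+ℓ₂≤d = ℕ.≤-trans (ℕ.+-monoˡ-≤ ℓ₂ (ℕ.m≤m+n d' ℓ₁)) d'+ℓ₁+ℓ₂≤d

    d'≤d∸ℓ₂ : d' ≤ d ∸ ℓ₂
    d'≤d∸ℓ₂ = ℕ.m+n≤o⇒m≤o∸n d' d'+ℓ₂≤d

    d'+ℓ₂≤d∸ℓ₁ : d' + ℓ₂ ≤ d ∸ ℓ₁
    d'+ℓ₂≤d∸ℓ₁ = ℕ.m+n≤o⇒m≤o∸n (d' + ℓ₂) (subst (_≤ d) (+-rightComm d' ℓ₁ ℓ₂) d'+ℓ₁+ℓ₂≤d)

  d'≤d : d' ≤ d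
  d'≤d = ℕ.≤-trans (ℕ.m≤m+n d' ℓ₂) d'+ℓ₂≤d

  length-roots : ∀ {k} → k ≤ d' → length (roots k) ≡ d' + ℓ₂
  length-roots {k} k≤d' = begin
    length (roots k)
      ≡⟨ length-++ (upTo k) ⟩
    length (upTo k) + length (interval (suc k) (d' ∸ k) ++ interval (suc (d ∸ ℓ₂)) ℓ₂)
      ≡⟨ cong₂ _+_ (length-upTo k) (length-++ (interval (suc k) (d' ∸ k))) ⟩
    k + (length (interval (suc k) (d' ∸ k)) + length (interval (suc (d ∸ ℓ₂)) ℓ₂))
      ≡⟨ cong (_+_ k) (cong₂ _+_ (length-interval (suc k) (d' ∸ k)) (length-interval (suc (d ∸ ℓ₂)) ℓ₂)) ⟩
    k + ((d' ∸ k) + ℓ₂)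
      ≡⟨ sym (ℕ.+-assoc k (d' ∸ k) ℓ₂) ⟩
    k + (d' ∸ k) + ℓ₂
      ≡⟨ cong (_+ ℓ₂) (ℕ.m+[n∸m]≡n k≤d') ⟩
    d' + ℓ₂ ∎

  ∈-roots : ∀ {k i} → i ≤ d' → i ≢ k → i ∈ roots k
  ∈-roots {k} {i} i≤d' i≢k with ℕ.<-cmp i k
  ... | tri< i<k _ _ = ∈-++⁺ˡ (∈-upTo⁺ i<k)
  ... | tri≈ _ i≡k _ = contradiction i≡k i≢k
  ... | tri> _ _ k<i = ∈-++⁺ʳ (upTo k) (∈-++⁺ˡ (∈-interval⁺ k<i
                         (s≤s (subst (i ≤_) (sym (ℕ.m+[n∸m]≡n (ℕ.<⇒≤ (ℕ.<-≤-trans k<i i≤d')))) i≤d'))))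

  ∉-roots : ∀ {k} → k ≤ d' → k ∉ roots k
  ∉-roots {k} k≤d' k∈roots with ∈-++⁻ (upTo k) k∈roots
  ... | inj₁ k∈upTo = ℕ.<-irrefl refl (∈-upTo⁻ k∈upTo)
  ... | inj₂ k∈intervals with ∈-++⁻ (interval (suc k) (d' ∸ k)) k∈intervals
  ...   | inj₁ k∈ = ℕ.<-irrefl refl (proj₁ (∈-interval⁻ k∈))
  ...   | inj₂ k∈ = ℕ.<⇒≱ (proj₁ (∈-interval⁻ k∈)) (ℕ.≤-trans k≤d' d'≤d∸ℓ₂)

  F-separating : Separating d' F
  F-separating k k≤d' =
    rootPoly-nonroot (∉-roots k≤d') , λ i i≤d' i≢k → rootPoly-root (∈-roots {k} i≤d' i≢k)

  F-vanishes-topStrip : ∀ k i j → k ≤ d' → d ∸ ℓ₁ < j → F k i j ≡ 0ℤ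
  F-vanishes-topStrip k i j k≤d' d∸ℓ₁<j =
    Degree≤-rootPoly (roots k) j
      (ℕ.≤-<-trans (ℕ.≤-trans (ℕ.≤-reflexive (length-roots k≤d')) d'+ℓ₂≤d∸ℓ₁) d∸ℓ₁<j) i

  F-vanishes-rightStrip : ∀ k i j → d ∸ ℓ₂ < i → i + j ≤ d → F k i j ≡ 0ℤ
  F-vanishes-rightStrip k i j d∸ℓ₂<i i+j≤d = Δ^-vanishes j (rootPoly (roots k)) i λ m i≤m m≤i+j →
    rootPoly-root (∈-++⁺ʳ (upTo k) (∈-++⁺ʳ (interval (suc k) (d' ∸ k))
      (∈-interval⁺ (ℕ.<-≤-trans d∸ℓ₂<i i≤m)
                   (s≤s (subst (m ≤_) (sym (ℕ.m∸n+n≡m ℓ₂≤d)) (ℕ.≤-trans m≤i+j i+j≤d))))))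
    where
    ℓ₂≤d : ℓ₂ ≤ d
    ℓ₂≤d = ℕ.≤-trans (ℕ.m≤n+m ℓ₂ d') d'+ℓ₂≤d

  SupportedInStrips : Config → Set
  SupportedInStrips w =
    ∀ i j → w i j ≢ 0ℤ → (i + j ≤ d') ⊎ ((i + j ≤ d × d ∸ ℓ₁ < j) ⊎ (i + j ≤ d × d ∸ ℓ₂ < i))

  ⊙F-beyond : ∀ {w} → SupportedInStrips w → ∀ {k} → k ≤ d' → ∀ i j → d' < i + j → (w ⊙ F k) i j ≡ 0ℤ
  ⊙F-beyond {w} w-supp {k} k≤d' i j d'<i+j with w i j ℤ.≟ 0ℤ
  ... | yes w≡0 = cong (ℤ._* F k i j) w≡0
  ... | no  w≢0 with w-supp i j w≢0
  ...   | inj₁ i+j≤d' = contradiction i+j≤d' (ℕ.<⇒≱ d'<i+j)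
  ...   | inj₂ (inj₁ (_ , d∸ℓ₁<j)) =
    trans (cong (ℤ._*_ (w i j)) (F-vanishes-topStrip k i j k≤d' d∸ℓ₁<j)) (ℤ.*-zeroʳ (w i j))
  ...   | inj₂ (inj₂ (i+j≤d , d∸ℓ₂<i)) =
    trans (cong (ℤ._*_ (w i j)) (F-vanishes-rightStrip k i j d∸ℓ₂<i i+j≤d)) (ℤ.*-zeroʳ (w i j))

  restrict⊙F : ∀ {w} → SupportedInStrips w → ∀ {k} → k ≤ d' →
               ∀ i j → (restrict d' w ⊙ F k) i j ≡ (w ⊙ F k) i j
  restrict⊙F {w} w-supp {k} k≤d' i j with ℕ.≤-<-connex (i + j) d'
  ... | inj₁ i+j≤d' = cong (ℤ._* F k i j) (restrict-≤ w i j i+j≤d')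
  ... | inj₂ d'<i+j =
    trans (cong (ℤ._* F k i j) (restrict-> w i j d'<i+j)) (sym (⊙F-beyond w-supp k≤d' i j d'<i+j))

  restriction-outcome : ∀ {w} → SupportedInStrips w → Outcome d w → Outcome d' (restrict d' w)
  restriction-outcome {w} w-supp w-out =
    outcome-of-annihilated d' (λ k → differenceTable-splitInvariant d' _) F-separating (restrict-> w)
      λ k k≤d' → begin
        ∑□ d' (u ⊙ F k) ≡⟨ sym (∑□-truncate d (u ⊙ F k) d'≤d λ i j → u⊙F-beyond k i j ∘ outside⇒d'<i+j) ⟩
        ∑□ d (u ⊙ F k)  ≡⟨ ∑□-cong d (λ i j _ _ → restrict⊙F w-supp k≤d' i j) ⟩
        ∑□ d (w ⊙ F k)  ≡⟨ ∑□-outcome d (differenceTable-splitInvariant d _) w-out ⟩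
        0ℤ              ∎
    where
    u : Config
    u = restrict d' w

    outside⇒d'<i+j : ∀ {i j} → d' < i ⊎ d' < j → d' < i + j
    outside⇒d'<i+j {i} {j} =
      [ (λ d'<i → ℕ.<-≤-trans d'<i (ℕ.m≤m+n i j)) , (λ d'<j → ℕ.<-≤-trans d'<j (ℕ.m≤n+m j i)) ]′

    u⊙F-beyond : ∀ k i j → d' < i + j → (u ⊙ F k) i j ≡ 0ℤ
    u⊙F-beyond k i j d'<i+j = cong (ℤ._* F k i j) (restrict-> w i j d'<i+j)

proposition7p1 : (d d' ℓ₁ ℓ₂ : ℕ) → 1 ≤ d' → d' ≤ ℓ₁ → d' ≤ ℓ₂ → d' + ℓ₁ + ℓ₂ ≤ d →
    (w : Config) →
    (∀ i j → w i j ≢ 0ℤ →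
      (i + j ≤ d') ⊎ ((i + j ≤ d × d ∸ ℓ₁ < j) ⊎ (i + j ≤ d × d ∸ ℓ₂ < i))) →
    (¬ Outcome d' (restrict d' w) → ¬ Outcome d w) ×
    (Outcome d w → Valid w → DegLe w d')
proposition7p1 d d' ℓ₁ ℓ₂ _ _ _ d'+ℓ₁+ℓ₂≤d w w-supp =
  (λ ¬u-out w-out → ¬u-out (restriction-outcome w-supp w-out)) ,
  (λ w-out → valid-outcome-degree w-out (Outcome-mono d'≤d (restriction-outcome w-supp w-out)))
  where
  open StripInvariants d d' ℓ₁ ℓ₂ d'+ℓ₁+ℓ₂≤d
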